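{- Let $M$ be a $c\times d$ matrix with entries in $\mathcal{A}_k=\{a_1,\dots,a_k\}$. Then $M$ does not satisfy the $k$-extraction property if and only if there exist $U\subseteq\{1,\dots,c\}$ and $V\subseteq\{1,\dots,d\}$ with $|V|=|U|-1$ such that for every $u\in U$ there is $b\in\mathcal{A}_k$ such that for all $1\le j\le d$, $M_{u,j}=b$ implies $j\in V$.
   Context: A $c\times d$ matrix $M$ with entries in $\mathcal{A}_k=\{a_1,\dots,a_k\}$ ($k$ distinct symbols) has the $k$-extraction property if for any $b_1,\dots,b_c\in\mathcal{A}_k$ there exist pairwise different $j_1,\dots,j_c\in\{1,\dots,d\}$ with $M_{i,j_i}=b_i$ for all $i$. -}

module Defs where

open import Data.Nat using (ℕ)
open import Data.Fin using (Fin)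
open import Data.Product using (Σ; _×_)
open import Function.Definitions using (Injective)
open import Relation.Binary.PropositionalEquality using (_≡_)

-- The alphabet 𝒜_k = {a_1,…,a_k} is represented by Fin k.
-- A c × d matrix with entries in 𝒜_k : rows indexed by Fin c, columns by Fin d.
Matrix : ℕ → ℕ → ℕ → Set
Matrix c d k = Fin c → Fin d → Fin k

ExtractionProperty : {c d k : ℕ} → Matrix c d k → Set
ExtractionProperty {c} {d} {k} M =
  (b : Fin c → Fin k) →
  Σ (Fin c → Fin d) (λ j → Injective _≡_ _≡_ j × ((i : Fin c) → M i (j i) ≡ b i))

-- For a fixed choice b, the columns j with M i j ≡ b i form a family of sets S i, and
-- extractions for b are exactly the transversals (systems of distinct representatives) of S.
-- By Hall's theorem S has no transversal iff some set U of rows has all its S u inside a set V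
-- of fewer than ∣ U ∣ columns; shrinking U makes ∣ V ∣ = ∣ U ∣ - 1, and b u is the symbol
-- forced on row u.  Hall's theorem is proved constructively, as "transversal or violator",
-- by Rado's induction on the total size of the family.
module Submission where

open import Defs
open import Data.Empty using (⊥-elim)
open import Data.Fin using (Fin; zero; suc; _≟_)
open import Data.Fin.Properties using (any?; all?; ¬∀⟶∃¬)
  renaming (suc-injective to Fin-suc-injective)
open import Data.Fin.Subset
open import Data.Fin.Subset.Properties
open import Data.Nat using (ℕ; zero; suc; _+_; _≤_; _<_; z≤n; s≤s; _<?_) renaming (_≟_ to _≟ℕ_)
open import Data.Nat.Induction using (<-wellFounded)
open import Data.Nat.Properties hiding (_≟_)
open import Data.Product using (Σ; ∃₂; _×_; _,_; proj₁; proj₂)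
open import Data.Sum using (_⊎_; inj₁; inj₂; [_,_]′)
open import Data.Vec.Base using (_∷_; []; tabulate; here; there)
open import Data.Vec.Functional using (updateAt)
open import Data.Vec.Functional.Properties using (updateAt-updates; updateAt-minimal)
open import Data.Vec.Properties using (lookup∘tabulate; lookup⇒[]=; []=⇒lookup)
open import Function using (_∘_)
open import Function.Bundles using (_⇔_; mk⇔)
open import Function.Definitions using (Injective)
open import Induction.WellFounded using (Acc; acc)
open import Relation.Nullary using (¬_; Dec; yes; no; does; contradiction)
open import Relation.Nullary.Decidable using (_×-dec_; _→-dec_; ¬?; dec-true; dec-false; decidable-stable)
open import Relation.Binary.PropositionalEquality

∣p∪q∣+∣p∩q∣≡∣p∣+∣q∣ : ∀ {n} (p q : Subset n) → ∣ p ∪ q ∣ + ∣ p ∩ q ∣ ≡ ∣ p ∣ + ∣ q ∣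
∣p∪q∣+∣p∩q∣≡∣p∣+∣q∣ [] [] = refl
∣p∪q∣+∣p∩q∣≡∣p∣+∣q∣ (inside ∷ p) (inside ∷ q) = cong suc (begin
  ∣ p ∪ q ∣ + suc ∣ p ∩ q ∣   ≡⟨ +-suc ∣ p ∪ q ∣ ∣ p ∩ q ∣ ⟩
  suc (∣ p ∪ q ∣ + ∣ p ∩ q ∣) ≡⟨ cong suc (∣p∪q∣+∣p∩q∣≡∣p∣+∣q∣ p q) ⟩
  suc (∣ p ∣ + ∣ q ∣)         ≡⟨ +-suc ∣ p ∣ ∣ q ∣ ⟨
  ∣ p ∣ + suc ∣ q ∣           ∎)
  where open ≡-Reasoning
∣p∪q∣+∣p∩q∣≡∣p∣+∣q∣ (inside ∷ p) (outside ∷ q) = cong suc (∣p∪q∣+∣p∩q∣≡∣p∣+∣q∣ p q)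
∣p∪q∣+∣p∩q∣≡∣p∣+∣q∣ (outside ∷ p) (inside ∷ q) =
  trans (cong suc (∣p∪q∣+∣p∩q∣≡∣p∣+∣q∣ p q)) (sym (+-suc ∣ p ∣ ∣ q ∣))
∣p∪q∣+∣p∩q∣≡∣p∣+∣q∣ (outside ∷ p) (outside ∷ q) = ∣p∪q∣+∣p∩q∣≡∣p∣+∣q∣ p q

x∈p⇒suc∣p-x∣≡∣p∣ : ∀ {n} {x : Fin n} {p : Subset n} → x ∈ p → suc ∣ p - x ∣ ≡ ∣ p ∣
x∈p⇒suc∣p-x∣≡∣p∣ {x = zero} {inside ∷ p} here = cong (suc ∘ ∣_∣) (p─⊥≡p p)
x∈p⇒suc∣p-x∣≡∣p∣ {x = suc x} {inside ∷ p} (there x∈p) = cong suc (x∈p⇒suc∣p-x∣≡∣p∣ x∈p)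
x∈p⇒suc∣p-x∣≡∣p∣ {x = suc x} {outside ∷ p} (there x∈p) = x∈p⇒suc∣p-x∣≡∣p∣ x∈p

x∈p-y⇒x≢y : ∀ {n} {x y : Fin n} {p : Subset n} → x ∈ p - y → x ≢ y
x∈p-y⇒x≢y {x = zero} {p = inside ∷ p} () refl
x∈p-y⇒x≢y {x = zero} {p = outside ∷ p} () refl
x∈p-y⇒x≢y {x = suc x} {p = _ ∷ p} (there x∈p-y) refl = x∈p-y⇒x≢y x∈p-y refl

∣p∣≡suc⇒Nonempty : ∀ {n m} (p : Subset n) → ∣ p ∣ ≡ suc m → Nonempty p
∣p∣≡suc⇒Nonempty (inside ∷ p) _ = zero , here
∣p∣≡suc⇒Nonempty (outside ∷ p) eq with ∣p∣≡suc⇒Nonempty p eq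
... | x , x∈p = suc x , there x∈p

∃q⊆p[∣q∣≡m] : ∀ {n} m (p : Subset n) → m ≤ ∣ p ∣ → Σ (Subset n) λ q → q ⊆ p × ∣ q ∣ ≡ m
∃q⊆p[∣q∣≡m] {n} zero p _ = ⊥ , ⊆-min p , ∣⊥∣≡0 n
∃q⊆p[∣q∣≡m] (suc m) (inside ∷ p) (s≤s m≤∣p∣) with ∃q⊆p[∣q∣≡m] m p m≤∣p∣
... | q , q⊆p , ∣q∣≡m = inside ∷ q , s⊆s q⊆p , cong suc ∣q∣≡m
∃q⊆p[∣q∣≡m] (suc m) (outside ∷ p) m≤∣p∣ with ∃q⊆p[∣q∣≡m] (suc m) p m≤∣p∣
... | q , q⊆p , ∣q∣≡m = outside ∷ q , s⊆s q⊆p , ∣q∣≡m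

injective⇒∣p∣≤∣q∣ : ∀ {c d} (f : Fin c → Fin d) → Injective _≡_ _≡_ f →
  (p : Subset c) (q : Subset d) → (∀ {x} → x ∈ p → f x ∈ q) → ∣ p ∣ ≤ ∣ q ∣
injective⇒∣p∣≤∣q∣ f inj [] q f[p]⊆q = z≤n
injective⇒∣p∣≤∣q∣ f inj (outside ∷ p) q f[p]⊆q =
  injective⇒∣p∣≤∣q∣ (f ∘ suc) (Fin-suc-injective ∘ inj) p q (f[p]⊆q ∘ there)
injective⇒∣p∣≤∣q∣ f inj (inside ∷ p) q f[p]⊆q = begin
  suc ∣ p ∣         ≤⟨ s≤s (injective⇒∣p∣≤∣q∣ (f ∘ suc) (Fin-suc-injective ∘ inj) p (q - f zero)
                                              f[p]⊆q-f0) ⟩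
  suc ∣ q - f zero ∣ ≡⟨ x∈p⇒suc∣p-x∣≡∣p∣ (f[p]⊆q here) ⟩
  ∣ q ∣             ∎
  where
  open ≤-Reasoning
  f[p]⊆q-f0 : ∀ {x} → x ∈ p → f (suc x) ∈ q - f zero
  f[p]⊆q-f0 x∈p = x∈p∧x≢y⇒x∈p-y (f[p]⊆q (there x∈p)) (λ eq → contradiction (inj eq) λ ())

Family : ℕ → ℕ → Set
Family c d = Fin c → Subset d

Transversal : ∀ {c d} → Family c d → Set
Transversal {c} {d} S = Σ (Fin c → Fin d) λ f → Injective _≡_ _≡_ f × (∀ i → f i ∈ S i)

Covers : ∀ {c d} → Family c d → Subset c → Subset d → Set
Covers S U V = ∀ {u} → u ∈ U → S u ⊆ V

HallViolator : ∀ {c d} → Family c d → Set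
HallViolator {c} {d} S = Σ (Subset c) λ U → Σ (Subset d) λ V → ∣ V ∣ < ∣ U ∣ × Covers S U V

HallViolator⇒¬Transversal : ∀ {c d} {S : Family c d} → HallViolator S → ¬ Transversal S
HallViolator⇒¬Transversal (U , V , ∣V∣<∣U∣ , cover) (f , inj , f∈S) =
  <⇒≱ ∣V∣<∣U∣ (injective⇒∣p∣≤∣q∣ f inj U V (λ u∈U → cover u∈U (f∈S _)))

Transversal-mono : ∀ {c d} {S T : Family c d} → (∀ i → S i ⊆ T i) → Transversal S → Transversal T
Transversal-mono S⊆T (f , inj , f∈S) = f , inj , λ i → S⊆T i (f∈S i)

totalSize : ∀ {c d} → Family c d → ℕ
totalSize {zero} S = 0
totalSize {suc c} S = ∣ S zero ∣ + totalSize (S ∘ suc)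

deleteAt : ∀ {c d} → Family c d → Fin c → Fin d → Family c d
deleteAt S r j = updateAt S r (_- j)

module _ {c d} (S : Family c d) (r : Fin c) (j : Fin d) where

  deleteAt-⊆ : ∀ i → deleteAt S r j i ⊆ S i
  deleteAt-⊆ i with i ≟ r
  ... | yes refl = subst (_⊆ S r) (sym (updateAt-updates r S)) (p─q⊆p (S r) ⁅ j ⁆)
  ... | no i≢r = ⊆-reflexive (updateAt-minimal i r S i≢r)

  deleteAt-⊇ : ∀ {i} → i ≢ r → S i ⊆ deleteAt S r j i
  deleteAt-⊇ {i} i≢r = ⊆-reflexive (sym (updateAt-minimal i r S i≢r))

  ∈-deleteAt : ∀ {x} → x ∈ S r → x ≢ j → x ∈ deleteAt S r j r
  ∈-deleteAt x∈Sr x≢j = subst (_ ∈_) (sym (updateAt-updates r S)) (x∈p∧x≢y⇒x∈p-y x∈Sr x≢j)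

  Covers-deleteAt-∉ : ∀ {U V} → r ∉ U → Covers (deleteAt S r j) U V → Covers S U V
  Covers-deleteAt-∉ {U} r∉U cover {u} u∈U =
    cover u∈U ∘ deleteAt-⊇ λ u≡r → r∉U (subst (_∈ U) u≡r u∈U)

totalSize-deleteAt : ∀ {c d} (S : Family c d) r {j} → j ∈ S r →
  totalSize (deleteAt S r j) < totalSize S
totalSize-deleteAt S zero j∈S₀ = +-monoˡ-< (totalSize (S ∘ suc)) (x∈p⇒∣p-x∣<∣p∣ j∈S₀)
totalSize-deleteAt S (suc r) j∈Sr = +-monoʳ-< ∣ S zero ∣ (totalSize-deleteAt (S ∘ suc) r j∈Sr)

deficient-∪-or-∩ : ∀ {a b p q u₁ u₂ v₁ v₂} → a + b ≡ u₁ + u₂ → p + q ≡ v₁ + v₂ →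
  v₁ < u₁ → v₂ < u₂ → p < a ⊎ suc q < b
deficient-∪-or-∩ {a} {b} {p} {q} {u₁} {u₂} {v₁} {v₂} a+b≡u₁+u₂ p+q≡v₁+v₂ v₁<u₁ v₂<u₂ with p <? a
... | yes p<a = inj₁ p<a
... | no p≮a = inj₂ (+-cancelˡ-≤ a (suc (suc q)) b (begin
  a + suc (suc q)     ≤⟨ +-monoˡ-≤ (suc (suc q)) (≮⇒≥ p≮a) ⟩
  p + suc (suc q)     ≡⟨ +-suc p (suc q) ⟩
  suc (p + suc q)     ≡⟨ cong suc (+-suc p q) ⟩
  suc (suc (p + q))   ≡⟨ cong (λ n → 2 + n) p+q≡v₁+v₂ ⟩
  suc (suc (v₁ + v₂)) ≡⟨ cong suc (+-suc v₁ v₂) ⟨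
  suc v₁ + suc v₂     ≤⟨ +-mono-≤ v₁<u₁ v₂<u₂ ⟩
  u₁ + u₂             ≡⟨ a+b≡u₁+u₂ ⟨
  a + b               ∎))
  where open ≤-Reasoning

-- Rado's step: two violators after deleting distinct j₁, j₂ from row r, both containing r,
-- give a violator of S by submodularity of ∣_∣.
module _ {c d} (S : Family c d) {r : Fin c} {j₁ j₂ : Fin d} (j₁≢j₂ : j₁ ≢ j₂)
         {U₁ U₂ : Subset c} {V₁ V₂ : Subset d} (r∈U₁ : r ∈ U₁) (r∈U₂ : r ∈ U₂)
         (cover₁ : Covers (deleteAt S r j₁) U₁ V₁) (cover₂ : Covers (deleteAt S r j₂) U₂ V₂) where

  private
    Sr⊆V₁∪V₂ : S r ⊆ V₁ ∪ V₂
    Sr⊆V₁∪V₂ {x} x∈Sr with x ≟ j₁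
    ... | yes refl = x∈p∪q⁺ (inj₂ (cover₂ r∈U₂ (∈-deleteAt S r j₂ x∈Sr j₁≢j₂)))
    ... | no x≢j₁ = x∈p∪q⁺ (inj₁ (cover₁ r∈U₁ (∈-deleteAt S r j₁ x∈Sr x≢j₁)))

  Covers-∪ : Covers S (U₁ ∪ U₂) (V₁ ∪ V₂)
  Covers-∪ {u} u∈U₁∪U₂ with u ≟ r | x∈p∪q⁻ U₁ U₂ u∈U₁∪U₂
  ... | yes refl | _ = Sr⊆V₁∪V₂
  ... | no u≢r | inj₁ u∈U₁ = p⊆p∪q V₂ ∘ cover₁ u∈U₁ ∘ deleteAt-⊇ S r j₁ u≢r
  ... | no u≢r | inj₂ u∈U₂ = q⊆p∪q V₁ V₂ ∘ cover₂ u∈U₂ ∘ deleteAt-⊇ S r j₂ u≢r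

  Covers-∩ : Covers S (U₁ ∩ U₂ - r) (V₁ ∩ V₂)
  Covers-∩ {u} u∈U₁∩U₂-r x∈Su with x∈p∩q⁻ U₁ U₂ (p─q⊆p (U₁ ∩ U₂) ⁅ r ⁆ u∈U₁∩U₂-r)
  ... | u∈U₁ , u∈U₂ = x∈p∩q⁺
    ( cover₁ u∈U₁ (deleteAt-⊇ S r j₁ u≢r x∈Su)
    , cover₂ u∈U₂ (deleteAt-⊇ S r j₂ u≢r x∈Su))
    where
    u≢r : u ≢ r
    u≢r = x∈p-y⇒x≢y u∈U₁∩U₂-r

  merge-HallViolators : ∣ V₁ ∣ < ∣ U₁ ∣ → ∣ V₂ ∣ < ∣ U₂ ∣ → HallViolator S
  merge-HallViolators ∣V₁∣<∣U₁∣ ∣V₂∣<∣U₂∣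
    with deficient-∪-or-∩ (∣p∪q∣+∣p∩q∣≡∣p∣+∣q∣ U₁ U₂) (∣p∪q∣+∣p∩q∣≡∣p∣+∣q∣ V₁ V₂)
                          ∣V₁∣<∣U₁∣ ∣V₂∣<∣U₂∣
  ... | inj₁ ∪-deficient = U₁ ∪ U₂ , V₁ ∪ V₂ , ∪-deficient , Covers-∪
  ... | inj₂ ∩-deficient =
    U₁ ∩ U₂ - r , V₁ ∩ V₂ , ≤-pred (subst (_ <_) ∣U₁∩U₂∣≡1+∣U₁∩U₂-r∣ ∩-deficient) , Covers-∩
    where
    ∣U₁∩U₂∣≡1+∣U₁∩U₂-r∣ : ∣ U₁ ∩ U₂ ∣ ≡ suc ∣ U₁ ∩ U₂ - r ∣
    ∣U₁∩U₂∣≡1+∣U₁∩U₂-r∣ = sym (x∈p⇒suc∣p-x∣≡∣p∣ (x∈p∩q⁺ (r∈U₁ , r∈U₂)))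

HasTwoElements : ∀ {n} → Subset n → Set
HasTwoElements p = ∃₂ λ x y → x ≢ y × x ∈ p × y ∈ p

hasTwoElements? : ∀ {n} (p : Subset n) → Dec (HasTwoElements p)
hasTwoElements? p = any? λ x → any? λ y → ¬? (x ≟ y) ×-dec x ∈? p ×-dec y ∈? p

¬HasTwoElements⇒⊆⁅⁆ : ∀ {n} {p : Subset n} {x} → ¬ HasTwoElements p → x ∈ p → p ⊆ ⁅ x ⁆
¬HasTwoElements⇒⊆⁅⁆ {x = x} ¬two x∈p {y} y∈p with y ≟ x
... | yes refl = x∈⁅x⁆ x
... | no y≢x = ⊥-elim (¬two (y , x , y≢x , y∈p , x∈p))

emptyRow⇒HallViolator : ∀ {c d} {S : Family c d} i → ¬ Nonempty (S i) → HallViolator S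
emptyRow⇒HallViolator {d = d} {S} i Si-empty = ⁅ i ⁆ , ⊥ , ∣⊥∣<∣⁅i⁆∣ , Si⊆⊥
  where
  ∣⊥∣<∣⁅i⁆∣ : ∣ ⊥ {d} ∣ < ∣ ⁅ i ⁆ ∣
  ∣⊥∣<∣⁅i⁆∣ rewrite ∣⊥∣≡0 d | ∣⁅x⁆∣≡1 i = s≤s z≤n
  Si⊆⊥ : Covers S ⁅ i ⁆ ⊥
  Si⊆⊥ u∈⁅i⁆ {x} x∈Su = ⊥-elim (Si-empty (x , subst (λ v → x ∈ S v) (x∈⁅y⁆⇒x≡y i u∈⁅i⁆) x∈Su))

collision⇒HallViolator : ∀ {c d} {S : Family c d} {i i' x} → i ≢ i' →
  S i ⊆ ⁅ x ⁆ → S i' ⊆ ⁅ x ⁆ → HallViolator S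
collision⇒HallViolator {S = S} {i} {i'} {x} i≢i' Si⊆x Si'⊆x =
  ⁅ i ⁆ ∪ ⁅ i' ⁆ , ⁅ x ⁆ , ∣⁅x⁆∣<∣⁅i,i'⁆∣ , cover
  where
  ⁅i⁆⊂⁅i,i'⁆ : ⁅ i ⁆ ⊂ ⁅ i ⁆ ∪ ⁅ i' ⁆
  ⁅i⁆⊂⁅i,i'⁆ = p⊆p∪q ⁅ i' ⁆ , i' , x∈p∪q⁺ (inj₂ (x∈⁅x⁆ i'))
             , λ i'∈⁅i⁆ → i≢i' (sym (x∈⁅y⁆⇒x≡y i i'∈⁅i⁆))
  ∣⁅x⁆∣<∣⁅i,i'⁆∣ : ∣ ⁅ x ⁆ ∣ < ∣ ⁅ i ⁆ ∪ ⁅ i' ⁆ ∣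
  ∣⁅x⁆∣<∣⁅i,i'⁆∣ = subst (_< _) (trans (∣⁅x⁆∣≡1 i) (sym (∣⁅x⁆∣≡1 x))) (p⊂q⇒∣p∣<∣q∣ ⁅i⁆⊂⁅i,i'⁆)
  cover : Covers S (⁅ i ⁆ ∪ ⁅ i' ⁆) ⁅ x ⁆
  cover {u} u∈⁅i,i'⁆ with x∈p∪q⁻ ⁅ i ⁆ ⁅ i' ⁆ u∈⁅i,i'⁆
  ... | inj₁ u∈⁅i⁆ rewrite x∈⁅y⁆⇒x≡y i u∈⁅i⁆ = Si⊆x
  ... | inj₂ u∈⁅i'⁆ rewrite x∈⁅y⁆⇒x≡y i' u∈⁅i'⁆ = Si'⊆x

hall-singletons : ∀ {c d} (S : Family c d) (f : Fin c → Fin d) →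
  (∀ i → f i ∈ S i) → (∀ i → S i ⊆ ⁅ f i ⁆) → Transversal S ⊎ HallViolator S
hall-singletons S f f∈S S⊆⁅f⁆ with any? (λ i → any? λ i' → ¬? (i ≟ i') ×-dec (f i ≟ f i'))
... | yes (i , i' , i≢i' , fi≡fi') =
  inj₂ (collision⇒HallViolator i≢i' (S⊆⁅f⁆ i) (subst (λ y → S i' ⊆ ⁅ y ⁆) (sym fi≡fi') (S⊆⁅f⁆ i')))
... | no noCollision = inj₁ (f , injective , f∈S)
  where
  injective : Injective _≡_ _≡_ f
  injective {i} {i'} fi≡fi' with i ≟ i'
  ... | yes i≡i' = i≡i'
  ... | no i≢i' = ⊥-elim (noCollision (i , i' , i≢i' , fi≡fi'))

hall-atMostOne : ∀ {c d} (S : Family c d) → (∀ i → ¬ HasTwoElements (S i)) →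
  Transversal S ⊎ HallViolator S
hall-atMostOne {c} S ¬two with all? (nonempty? ∘ S)
... | yes nonempty = hall-singletons S (proj₁ ∘ nonempty) (proj₂ ∘ nonempty)
  (λ i → ¬HasTwoElements⇒⊆⁅⁆ (¬two i) (proj₂ (nonempty i)))
... | no ¬allNonempty with ¬∀⟶∃¬ c _ (nonempty? ∘ S) ¬allNonempty
...   | i , Si-empty = inj₂ (emptyRow⇒HallViolator i Si-empty)

-- Deleting one of two elements of a row shrinks totalSize; a violator of a deletion avoiding r
-- is already a violator of S, so only violators through r for both deletions need merging.
hall-acc : ∀ {c d} (S : Family c d) → Acc _<_ (totalSize S) → Transversal S ⊎ HallViolator S
hall-acc S (acc smaller) with any? (hasTwoElements? ∘ S)
... | no noRowHasTwo = hall-atMostOne S λ i two → noRowHasTwo (i , two)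
... | yes (r , j₁ , j₂ , j₁≢j₂ , j₁∈Sr , j₂∈Sr)
  with hall-acc (deleteAt S r j₁) (smaller (totalSize-deleteAt S r j₁∈Sr))
     | hall-acc (deleteAt S r j₂) (smaller (totalSize-deleteAt S r j₂∈Sr))
... | inj₁ t | _ = inj₁ (Transversal-mono (deleteAt-⊆ S r j₁) t)
... | _ | inj₁ t = inj₁ (Transversal-mono (deleteAt-⊆ S r j₂) t)
... | inj₂ (U₁ , V₁ , ∣V₁∣<∣U₁∣ , cover₁) | inj₂ (U₂ , V₂ , ∣V₂∣<∣U₂∣ , cover₂)
  with r ∈? U₁ | r ∈? U₂
... | no r∉U₁ | _ = inj₂ (U₁ , V₁ , ∣V₁∣<∣U₁∣ , Covers-deleteAt-∉ S r j₁ r∉U₁ cover₁)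
... | _ | no r∉U₂ = inj₂ (U₂ , V₂ , ∣V₂∣<∣U₂∣ , Covers-deleteAt-∉ S r j₂ r∉U₂ cover₂)
... | yes r∈U₁ | yes r∈U₂ =
  inj₂ (merge-HallViolators S j₁≢j₂ r∈U₁ r∈U₂ cover₁ cover₂ ∣V₁∣<∣U₁∣ ∣V₂∣<∣U₂∣)

hall : ∀ {c d} (S : Family c d) → Transversal S ⊎ HallViolator S
hall S = hall-acc S (<-wellFounded (totalSize S))

preimage : ∀ {d k} → (Fin d → Fin k) → Fin k → Subset d
preimage g t = tabulate λ j → does (g j ≟ t)

∈-preimage⁺ : ∀ {d k} (g : Fin d → Fin k) {t j} → g j ≡ t → j ∈ preimage g t
∈-preimage⁺ g {t} {j} gj≡t =
  lookup⇒[]= j _ (trans (lookup∘tabulate _ j) (dec-true (g j ≟ t) gj≡t))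

∈-preimage⁻ : ∀ {d k} (g : Fin d → Fin k) {t j} → j ∈ preimage g t → g j ≡ t
∈-preimage⁻ g {t} {j} j∈ = decidable-stable (g j ≟ t) λ gj≢t → contradiction
  (trans (sym ([]=⇒lookup j∈)) (trans (lookup∘tabulate _ j) (dec-false (g j ≟ t) gj≢t))) λ ()

choiceFamily : ∀ {c d k} → Matrix c d k → (Fin c → Fin k) → Family c d
choiceFamily M b i = preimage (M i) (b i)

ExtractionObstruction : ∀ {c d k} → Matrix c d k → Set
ExtractionObstruction {c} {d} {k} M =
  Σ (Subset c) λ U → Σ (Subset d) λ V → suc ∣ V ∣ ≡ ∣ U ∣ ×
    ((u : Fin c) → u ∈ U → Σ (Fin k) λ b → (j : Fin d) → M u j ≡ b → j ∈ V)

module _ {c d k} (M : Matrix c d k) where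

  extractionObstruction? : Dec (ExtractionObstruction M)
  extractionObstruction? = anySubset? λ U → anySubset? λ V → suc ∣ V ∣ ≟ℕ ∣ U ∣ ×-dec
    all? (λ u → u ∈? U →-dec any? (λ b → all? λ j → M u j ≟ b →-dec j ∈? V))

  HallViolator⇒ExtractionObstruction : ∀ {b} → HallViolator (choiceFamily M b) →
    ExtractionObstruction M
  HallViolator⇒ExtractionObstruction {b} (U , V , ∣V∣<∣U∣ , cover)
    with ∃q⊆p[∣q∣≡m] (suc ∣ V ∣) U ∣V∣<∣U∣
  ... | U' , U'⊆U , ∣U'∣≡1+∣V∣ = U' , V , sym ∣U'∣≡1+∣V∣ ,
    λ u u∈U' → b u , λ j Muj≡bu → cover (U'⊆U u∈U') (∈-preimage⁺ (M u) Muj≡bu)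

  ExtractionObstruction⇒HallViolator : ExtractionObstruction M →
    Σ (Fin c → Fin k) λ b → HallViolator (choiceFamily M b)
  ExtractionObstruction⇒HallViolator (U , V , 1+∣V∣≡∣U∣ , forced) =
    b , U , V , ≤-reflexive 1+∣V∣≡∣U∣ , cover
    where
    U-nonempty : Nonempty U
    U-nonempty = ∣p∣≡suc⇒Nonempty U (sym 1+∣V∣≡∣U∣)
    -- outside U the choice is irrelevant, but a symbol must be supplied
    pick : (i : Fin c) → Dec (i ∈ U) → Fin k
    pick i (yes i∈U) = proj₁ (forced i i∈U)
    pick i (no _) = proj₁ (forced _ (proj₂ U-nonempty))
    b : Fin c → Fin k
    b i = pick i (i ∈? U)
    cover : Covers (choiceFamily M b) U V
    cover {u} u∈U j∈ with u ∈? U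
    ... | yes u∈U' = proj₂ (forced u u∈U') _ (∈-preimage⁻ (M u) j∈)
    ... | no u∉U = contradiction u∈U u∉U

  extraction⇒Transversal : ExtractionProperty M → ∀ b → Transversal (choiceFamily M b)
  extraction⇒Transversal ext b with ext b
  ... | j , inj , M[j]≡b = j , inj , λ i → ∈-preimage⁺ (M i) (M[j]≡b i)

  Transversal⇒extraction : ∀ {b} → Transversal (choiceFamily M b) →
    Σ (Fin c → Fin d) λ j → Injective _≡_ _≡_ j × (∀ i → M i (j i) ≡ b i)
  Transversal⇒extraction (j , inj , j∈) = j , inj , λ i → ∈-preimage⁻ (M i) (j∈ i)

-- The forward direction needs a case split on the decidable obstruction:
-- constructively, ¬ ExtractionProperty M does not name a failing choice b.
proposition4p5 : (c d k : ℕ) (M : Matrix c d k) →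
    (¬ ExtractionProperty M) ⇔
      Σ (Subset c) (λ U → Σ (Subset d) (λ V →
        (suc ∣ V ∣ ≡ ∣ U ∣) ×
        ((u : Fin c) → u ∈ U →
          Σ (Fin k) (λ b → (j : Fin d) → M u j ≡ b → j ∈ V))))
proposition4p5 c d k M = mk⇔ obstruction-of-¬extraction ¬extraction-of-obstruction
  where
  obstruction-of-¬extraction : ¬ ExtractionProperty M → ExtractionObstruction M
  obstruction-of-¬extraction ¬ext with extractionObstruction? M
  ... | yes obstruction = obstruction
  ... | no ¬obstruction = contradiction extraction ¬ext
    where
    extraction : ExtractionProperty M
    extraction b = [ Transversal⇒extraction M
                   , ⊥-elim ∘ ¬obstruction ∘ HallViolator⇒ExtractionObstruction M
                   ]′ (hall (choiceFamily M b))
  ¬extraction-of-obstruction : ExtractionObstruction M → ¬ ExtractionProperty M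
  ¬extraction-of-obstruction obstruction ext with ExtractionObstruction⇒HallViolator M obstruction
  ... | b , violator = HallViolator⇒¬Transversal violator (extraction⇒Transversal M ext b)
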